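{- Let $r,s,k$ be integers with $0\le r,s\le k$. If $r\le s$, then as formal power series \[ \sum_{n\ge0}\mu^{\le k}_{n,r,s}x^n=\frac{P^*_r(x)\,\delta^{s+1}P^*_{k-s}(x)}{P^*_{k+1}(x)}\cdot x^{s-r}. \] If $r>s$, then \[ \sum_{n\ge0}\mu^{\le k}_{n,r,s}x^n=\frac{P^*_s(x)\,\delta^{r+1}P^*_{k-r}(x)}{P^*_{k+1}(x)}\cdot\prod_{i=s+1}^{r}(a_i+\lambda_ix). \]
   Context: Let $b=\{b_n\}_{n\ge0}$, $a=\{a_n\}_{n\ge0}$, $\lambda=\{\lambda_n\}_{n\ge0}$ be sequences of complex numbers. Let $P_n(x)=P_n(x;b,a,\lambda)$ be defined by $P_{ -1}=0$, $P_0=1$, $P_{n+1}(x)=(x-b_n)P_n(x)-(a_nx+\lambda_n)P_{n-1}(x)$, and let $P^*_n(x)=P^*_n(x;b,a,\lambda)=x^nP_n(1/x)$ (so $P^*_n(0)=1$). For a sequence $s=\{s_n\}_{n\ge0}$ let $\delta s=\{s_{n+1}\}_{n\ge0}$, and $\delta^jP^*_n(x)=P^*_n(x;\delta^jb,\delta^ja,\delta^j\lambda)$. A Motzkin–Schröder path is a lattice path never going below the $x$-axis with steps up $(1,1)$, horizontal $(1,0)$, vertical down $(0,-1)$, diagonal down $(1,-1)$; its weight is the product of step weights, where up steps have weight $1$, a horizontal step starting at height $h$ has weight $b_h$, a vertical down step starting at height $h$ has weight $a_h$, and a diagonal down step starting at height $h$ has weight $\lambda_h$. Let $\mu^{\le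 k}_{n,r,s}$ be the sum of weights of all Motzkin–Schröder paths from $(0,r)$ to $(n,s)$ all of whose points have $y$-coordinate at most $k$. -}

module Defs where

open import Level using (Level)
open import Algebra.Bundles using (CommutativeRing)
open import Data.Nat using (ℕ; zero; suc; _≤_; _∸_; _≤?_; _≟_) renaming (_+_ to _+ℕ_)
open import Data.List using (List; []; _∷_; _++_; map; foldr)
open import Data.Product using (_×_; _,_; proj₁; proj₂)
open import Relation.Nullary using (Dec; yes; no)
open import Relation.Binary.PropositionalEquality using (_≡_; refl)

module Series {c ℓ : Level} (R : CommutativeRing c ℓ) where
  open CommutativeRing R hiding (zero)

  -- sequences / formal power series / polynomials are all coefficient
  -- functions ℕ → Carrier
  Seq : Set c
  Seq = ℕ → Carrier

  _≋_ : Seq → Seq → Set ℓ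
  f ≋ g = ∀ n → f n ≈ g n

  sumBelow : ℕ → (ℕ → Carrier) → Carrier
  sumBelow zero    f = 0#
  sumBelow (suc n) f = sumBelow n f + f n

  _⋆_ : Seq → Seq → Seq
  (f ⋆ g) n = sumBelow (suc n) (λ i → f i * g (n ∸ i))

  xPow : ℕ → Seq
  xPow m n with m ≟ n
  ... | yes _ = 1#
  ... | no  _ = 0#

  zeroS : Seq
  zeroS _ = 0#

  oneS : Seq
  oneS = xPow 0

  linS : Carrier → Carrier → Seq
  linS c₀ c₁ zero          = c₀
  linS c₀ c₁ (suc zero)    = c₁
  linS c₀ c₁ (suc (suc _)) = 0#

  xTimes : Seq → Seq
  xTimes f zero    = 0#
  xTimes f (suc n) = f n

  scale : Carrier → Seq → Seq
  scale d f n = d * f n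

  _⊖_ : Seq → Seq → Seq
  (f ⊖ g) n = f n - g n

  _⊕_ : Seq → Seq → Seq
  (f ⊕ g) n = f n + g n

  -- multiplicative inverse of a formal power series f with f 0 = 1:
  -- g 0 = 1,  g n = - Σ_{j=1}^{n} f j * g (n - j).
  -- invList f n = [g n , g (n-1) , … , g 0]
  nth : List Carrier → ℕ → Carrier
  nth []       _       = 0#
  nth (x ∷ _)  zero    = x
  nth (_ ∷ xs) (suc i) = nth xs i

  invList : Seq → ℕ → List Carrier
  invList f zero    = 1# ∷ []
  invList f (suc n) =
    (- sumBelow (suc n) (λ i → f (suc i) * nth (invList f n) i)) ∷ invList f n

  inv : Seq → Seq
  inv f n = nth (invList f n) 0

  shiftSeq : ℕ → Seq → Seq
  shiftSeq j s i = s (j +ℕ i)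

  -- (P_{n-1}, P_n) as coefficient functions, with P_{-1} = 0, P_0 = 1,
  -- P_{n+1}(x) = (x - b_n) P_n(x) - (a_n x + λ_n) P_{n-1}(x)
  PPair : (b a lam : Seq) → ℕ → Seq × Seq
  PPair b a lam zero    = zeroS , oneS
  PPair b a lam (suc n) with PPair b a lam n
  ... | (Pm , Pn) = Pn , ((xTimes Pn ⊖ scale (b n) Pn)
                          ⊖ (scale (a n) (xTimes Pm) ⊕ scale (lam n) Pm))

  P : (b a lam : Seq) → ℕ → Seq
  P b a lam n = proj₂ (PPair b a lam n)

  -- P*_n(x) = x^n P_n(1/x)   (coefficient reversal; deg P_n ≤ n)
  Pstar : (b a lam : Seq) → ℕ → Seq
  Pstar b a lam n m with m ≤? n
  ... | yes _ = P b a lam n (n ∸ m)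
  ... | no  _ = 0#

  δPstar : (b a lam : Seq) → ℕ → ℕ → Seq
  δPstar b a lam j n = Pstar (shiftSeq j b) (shiftSeq j a) (shiftSeq j lam) n

  prodLin : (a lam : Seq) → ℕ → ℕ → Seq
  prodLin a lam s zero    = oneS
  prodLin a lam s (suc m) =
    prodLin a lam s m ⋆ linS (a (s +ℕ suc m)) (lam (s +ℕ suc m))

  -- Motzkin–Schröder paths of x-length n from height h to height t, all of
  -- whose points have height ≤ k.  Each constructor records that the
  -- starting point of its step has height ≤ k.
  data Path (k : ℕ) : ℕ → ℕ → ℕ → Set where
    done : ∀ {h} → h ≤ k → Path k 0 h h
    up   : ∀ {n h t} → h ≤ k → Path k n (suc h) t → Path k (suc n) h t
    hor  : ∀ {n h t} → h ≤ k → Path k n h t → Path k (suc n) h t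
    vert : ∀ {n h t} → suc h ≤ k → Path k n h t → Path k n (suc h) t
    diag : ∀ {n h t} → suc h ≤ k → Path k n h t → Path k (suc n) (suc h) t

  weight : (b a lam : Seq) → ∀ {k n h t} → Path k n h t → Carrier
  weight b a lam (done _)            = 1#
  weight b a lam (up _ p)            = weight b a lam p
  weight b a lam (hor {h = h} _ p)   = b h * weight b a lam p
  weight b a lam (vert {h = h} _ p)  = a (suc h) * weight b a lam p
  weight b a lam (diag {h = h} _ p)  = lam (suc h) * weight b a lam p

  guard : ∀ {A : Set} {h k} → Dec (h ≤ k) → (h ≤ k → List A) → List A
  guard (yes p) f = f p
  guard (no _)  f = []

  doneCase : ∀ k h t → List (Path k 0 h t)
  doneCase k h t with h ≟ t
  ... | yes refl = guard (h ≤? k) (λ p → done p ∷ [])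
  ... | no _     = []

  allPaths : ∀ k n h t → List (Path k n h t)
  allPaths k zero zero t    = doneCase k zero t
  allPaths k zero (suc h) t =
    doneCase k (suc h) t
    ++ guard (suc h ≤? k) (λ p → map (vert p) (allPaths k zero h t))
  allPaths k (suc n) zero t =
    guard (zero ≤? k) (λ p → map (up p) (allPaths k n 1 t)
                           ++ map (hor p) (allPaths k n zero t))
  allPaths k (suc n) (suc h) t =
    guard (suc h ≤? k) (λ p →
         map (up p) (allPaths k n (suc (suc h)) t)
      ++ map (hor p) (allPaths k n (suc h) t)
      ++ map (vert p) (allPaths k (suc n) h t)
      ++ map (diag p) (allPaths k n h t))

  μ : (b a lam : Seq) → (k n r s : ℕ) → Carrier
  μ b a lam k n r s = foldr _+_ 0# (map (weight b a lam) (allPaths k n r s))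

-- Split the weighted paths from height h to height t by their first step: the generating
-- functions F_h satisfy the linear system F_h = x F_{h+1} + b_h x F_h + (a_h + λ_h x) F_{h-1} + [h = t]
-- for h ≤ k, with F_{k+1} = 0, and this system has a unique solution because coefficient n of F_h is
-- determined by lower coefficients and by F_{h-1}.  So it suffices to check that the claimed series
-- solve it.  Multiplied by P*_{k+1} they become products of the reversed polynomials δ^j P*_n,
-- continuants of a three-term recurrence, and the system reduces to that recurrence together with
-- the splitting identity P*_{m+n+1} = P*_{m+1} δ^{m+1}P*_n - (a_{m+1} x + λ_{m+1} x²) P*_m δ^{m+2}P*_{n-1}.

module Submission where

open import Defs
open import Algebra.Bundles using (CommutativeRing; Semiring)
import Algebra.Construct.Pointwise as Pointwise
open import Data.Nat using (ℕ; zero; suc; _≤_; _<_; _∸_; s≤s; _≤?_; _≟_) renaming (_+_ to _+ℕ_)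
import Data.Nat.Properties as ℕ
open import Data.Nat.Solver using (module +-*-Solver)
open import Data.Product using (_×_; _,_; proj₁; proj₂)
open import Data.Sum using (inj₁; inj₂)
open import Data.Empty using (⊥-elim)
open import Data.List using (List; []; _∷_; _++_; map; foldr)
open import Relation.Nullary using (Dec; yes; no; ¬_)
open import Relation.Binary.Definitions using (tri<; tri≈; tri>)
open import Relation.Binary.PropositionalEquality as ≡ using (_≡_; _≢_)

[i+1+m]+1+n≡i+[1+n+1+m] : ∀ i m n → (i +ℕ suc m) +ℕ suc n ≡ i +ℕ (suc n +ℕ suc m)
[i+1+m]+1+n≡i+[1+n+1+m] =
  solve 3 (λ i m n → (i :+ (con 1 :+ m)) :+ (con 1 :+ n) := i :+ ((con 1 :+ n) :+ (con 1 :+ m))) ≡.refl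
  where open +-*-Solver

1+[i+1+m]+n≡i+[1+n+1+m] : ∀ i m n → suc (i +ℕ suc m) +ℕ n ≡ i +ℕ (suc n +ℕ suc m)
1+[i+1+m]+n≡i+[1+n+1+m] =
  solve 3 (λ i m n → (con 1 :+ (i :+ (con 1 :+ m))) :+ n := i :+ ((con 1 :+ n) :+ (con 1 :+ m))) ≡.refl
  where open +-*-Solver

module Continuants {c ℓ} (S : CommutativeRing c ℓ) where
  open CommutativeRing S
  open import Relation.Binary.Reasoning.Setoid setoid
  open import Algebra.Properties.AbelianGroup +-abelianGroup using (∙-cancelʳ)
  open import Algebra.Solver.Ring.NaturalCoefficients.Default commutativeSemiring
  open import Algebra.Definitions.RawSemiring (Semiring.rawSemiring semiring) using (_^_)

  prev : (ℕ → Carrier) → ℕ → Carrier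
  prev u zero    = 0#
  prev u (suc n) = u n

  single : ℕ → Carrier → ℕ → Carrier
  single t v h with h ≟ t
  ... | yes _ = v
  ... | no  _ = 0#

  single-self : ∀ t v → single t v t ≈ v
  single-self t v with t ≟ t
  ... | yes _   = refl
  ... | no  t≢t = ⊥-elim (t≢t ≡.refl)

  single-other : ∀ {t h} v → h ≢ t → single t v h ≈ 0#
  single-other {t} {h} v h≢t with h ≟ t
  ... | yes h≡t = ⊥-elim (h≢t h≡t)
  ... | no  _   = refl

  single-*ʳ : ∀ {t v d w} → v * d ≈ w → ∀ h → single t v h * d ≈ single t w h
  single-*ʳ {t} {d = d} v*d≈w h with h ≟ t
  ... | yes _ = v*d≈w
  ... | no  _ = zeroˡ d

  module _ (B C : ℕ → Carrier) where

    -- δ^j P* satisfies this with B h = b_h x and C h = a_h x + λ_h x²: it is the recurrence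
    -- P*_{n+1} = (1 - b_n x) P*_n - (a_n x + λ_n x²) P*_{n-1}, written without subtraction.
    IsContinuant : ℕ → (ℕ → Carrier) → Set ℓ
    IsContinuant j u =
      u 0 ≈ 1# × (∀ n → u (suc n) + (B (j +ℕ n) * u n + C (j +ℕ n) * prev u n) ≈ u n)

    continuant-recurrence : ∀ {j u} → IsContinuant j u → ∀ n {h} → j +ℕ n ≡ h →
                            u (suc n) + (B h * u n + C h * prev u n) ≈ u n
    continuant-recurrence u-cont n ≡.refl = proj₂ u-cont n

    module Splitting (K : ℕ → ℕ → Carrier) (K-cont : ∀ j → IsContinuant j (K j)) where

      K-initial : ∀ j → K j 0 ≈ 1#
      K-initial j = proj₁ (K-cont j)

      K-recurrence : ∀ j n → K j (suc n) + (B (j +ℕ n) * K j n + C (j +ℕ n) * prev (K j) n) ≈ K j n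
      K-recurrence j = proj₂ (K-cont j)

      splitting : ∀ i m j → i +ℕ suc m ≡ j → ∀ n →
        K i (n +ℕ suc m) + (C j * K i m) * prev (K (suc j)) n ≈ K i (suc m) * K j n
      splitting i m _ ≡.refl n = proj₁ (splits n)
        where
        Q  = K i
        S′ = K (i +ℕ suc m)
        T  = K (suc (i +ℕ suc m))
        κ  = C (i +ℕ suc m) * Q m

        Splits : ℕ → Set ℓ
        Splits n = Q (n +ℕ suc m) + κ * prev T n ≈ Q (suc m) * S′ n

        cancel-via : ∀ {u v w z} → u + w ≈ z → v + w ≈ z → u ≈ v
        cancel-via {u} {v} {w} u+w≈z v+w≈z = ∙-cancelʳ w u v (trans u+w≈z (sym v+w≈z))

        split₀ : Splits 0
        split₀ = begin
          Q (suc m) + κ * 0#  ≈⟨ solve 2 (λ q k → q :+ k :* con 0 := q :* con 1) refl (Q (suc m)) κ ⟩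
          Q (suc m) * 1#      ≈⟨ *-congˡ (sym (K-initial (i +ℕ suc m))) ⟩
          Q (suc m) * S′ 0    ∎

        split₁ : Splits 1
        split₁ = cancel-via {w = B′ * Q (suc m)} lhs rhs
          where
          B′ = B (i +ℕ suc m)
          C′ = C (i +ℕ suc m)
          lhs : (Q (suc (suc m)) + κ * T 0) + B′ * Q (suc m) ≈ Q (suc m)
          lhs = begin
            (Q (suc (suc m)) + κ * T 0) + B′ * Q (suc m)
              ≈⟨ +-congʳ (+-congˡ (*-congˡ (K-initial (suc (i +ℕ suc m))))) ⟩
            (Q (suc (suc m)) + κ * 1#) + B′ * Q (suc m)
              ≈⟨ solve 5 (λ q₂ q₁ q₀ b c → (q₂ :+ (c :* q₀) :* con 1) :+ b :* q₁ := q₂ :+ (b :* q₁ :+ c :* q₀))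
                   refl (Q (suc (suc m))) (Q (suc m)) (Q m) B′ C′ ⟩
            Q (suc (suc m)) + (B′ * Q (suc m) + C′ * Q m)
              ≈⟨ K-recurrence i (suc m) ⟩
            Q (suc m) ∎
          rhs : Q (suc m) * S′ 1 + B′ * Q (suc m) ≈ Q (suc m)
          rhs = begin
            Q (suc m) * S′ 1 + B′ * Q (suc m)
              ≈⟨ solve 4 (λ q s b c → q :* s :+ b :* q := q :* (s :+ (b :* con 1 :+ c :* con 0)))
                   refl (Q (suc m)) (S′ 1) B′ C′ ⟩
            Q (suc m) * (S′ 1 + (B′ * 1# + C′ * 0#))
              ≈⟨ *-congˡ (+-congˡ (+-congʳ (*-congˡ (sym (K-initial (i +ℕ suc m)))))) ⟩
            Q (suc m) * (S′ 1 + (B′ * S′ 0 + C′ * 0#))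
              ≈⟨ *-congˡ (continuant-recurrence (K-cont (i +ℕ suc m)) 0 (ℕ.+-identityʳ _)) ⟩
            Q (suc m) * S′ 0
              ≈⟨ trans (*-congˡ (K-initial (i +ℕ suc m))) (*-identityʳ _) ⟩
            Q (suc m) ∎

        -- Adding W, both sides become Q (m+1) S′ (n+1) by the recurrences of Q, S′ and T at index J.
        split₊₂ : ∀ n → Splits n → Splits (suc n) → Splits (suc (suc n))
        split₊₂ n IH₀ IH₁ = cancel-via {w = W} lhs rhs
          where
          J  = i +ℕ (suc n +ℕ suc m)
          B′ = B J
          C′ = C J
          L₀ = Q (n +ℕ suc m)
          L₁ = Q (suc n +ℕ suc m)
          L₂ = Q (suc (suc n) +ℕ suc m)
          W  = B′ * (Q (suc m) * S′ (suc n)) + C′ * (Q (suc m) * S′ n)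
          lhs : (L₂ + κ * T (suc n)) + W ≈ Q (suc m) * S′ (suc n)
          lhs = begin
            (L₂ + κ * T (suc n)) + W
              ≈⟨ +-congˡ (+-cong (*-congˡ (sym IH₁)) (*-congˡ (sym IH₀))) ⟩
            (L₂ + κ * T (suc n)) + (B′ * (L₁ + κ * T n) + C′ * (L₀ + κ * prev T n))
              ≈⟨ solve 9 (λ l₂ k t₂ b l₁ t₁ c l₀ t₀ →
                   (l₂ :+ k :* t₂) :+ (b :* (l₁ :+ k :* t₁) :+ c :* (l₀ :+ k :* t₀))
                     := (l₂ :+ (b :* l₁ :+ c :* l₀)) :+ k :* (t₂ :+ (b :* t₁ :+ c :* t₀)))
                   refl L₂ κ (T (suc n)) B′ L₁ (T n) C′ L₀ (prev T n) ⟩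
            (L₂ + (B′ * L₁ + C′ * L₀)) + κ * (T (suc n) + (B′ * T n + C′ * prev T n))
              ≈⟨ +-cong (continuant-recurrence (K-cont i) (suc n +ℕ suc m) ≡.refl)
                        (*-congˡ (continuant-recurrence (K-cont (suc (i +ℕ suc m))) n (1+[i+1+m]+n≡i+[1+n+1+m] i m n))) ⟩
            L₁ + κ * T n
              ≈⟨ IH₁ ⟩
            Q (suc m) * S′ (suc n) ∎
          rhs : Q (suc m) * S′ (suc (suc n)) + W ≈ Q (suc m) * S′ (suc n)
          rhs = begin
            Q (suc m) * S′ (suc (suc n)) + W
              ≈⟨ solve 6 (λ q s₂ b s₁ c s₀ → q :* s₂ :+ (b :* (q :* s₁) :+ c :* (q :* s₀))
                           := q :* (s₂ :+ (b :* s₁ :+ c :* s₀)))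
                   refl (Q (suc m)) (S′ (suc (suc n))) B′ (S′ (suc n)) C′ (S′ n) ⟩
            Q (suc m) * (S′ (suc (suc n)) + (B′ * S′ (suc n) + C′ * S′ n))
              ≈⟨ *-congˡ (continuant-recurrence (K-cont (i +ℕ suc m)) (suc n) ([i+1+m]+1+n≡i+[1+n+1+m] i m n)) ⟩
            Q (suc m) * S′ (suc n) ∎

        splits : ∀ n → Splits n × Splits (suc n)
        splits zero    = split₀ , split₁
        splits (suc n) = proj₂ (splits n) , split₊₂ n (proj₁ (splits n)) (proj₂ (splits n))

      K-one : ∀ h → K h 1 + B h ≈ 1#
      K-one h = begin
        K h 1 + B h
          ≈⟨ solve 3 (λ u b c → u :+ b := u :+ (b :* con 1 :+ c :* con 0)) refl (K h 1) (B h) (C h) ⟩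
        K h 1 + (B h * 1# + C h * 0#)      ≈⟨ +-congˡ (+-congʳ (*-congˡ (sym (K-initial h)))) ⟩
        K h 1 + (B h * K h 0 + C h * 0#)   ≈⟨ continuant-recurrence (K-cont h) 0 (ℕ.+-identityʳ h) ⟩
        K h 0                              ≈⟨ K-initial h ⟩
        1# ∎

      splitting-bottom : ∀ h n → K h (suc n) + C (suc h) * prev (K (suc (suc h))) n ≈ K h 1 * K (suc h) n
      splitting-bottom h n = begin
        K h (suc n) + C (suc h) * T
          ≈⟨ +-cong (reflexive (≡.cong (K h) (ℕ.+-comm 1 n)))
                    (*-congʳ (sym (trans (*-congˡ (K-initial h)) (*-identityʳ _)))) ⟩
        K h (n +ℕ 1) + (C (suc h) * K h 0) * T
          ≈⟨ splitting h 0 (suc h) (ℕ.+-comm h 1) n ⟩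
        K h 1 * K (suc h) n ∎
        where T = prev (K (suc (suc h))) n

  module PathSystem (x : Carrier) (A B : ℕ → Carrier) where

    C : ℕ → Carrier
    C h = A h * x

    -- With A h = a_h + λ_h x and B h = b_h x, this is the decomposition of paths from height h
    -- by their first step (up, horizontal, or down to h - 1); X (k + 1) = 0 is the ceiling.
    IsSolution : ℕ → (ℕ → Carrier) → (ℕ → Carrier) → Set ℓ
    IsSolution k E X =
      (∀ h → h ≤ k → X h ≈ x * X (suc h) + (B h * X h + (A h * prev X h + E h))) × X (suc k) ≈ 0#

    IsSolution-*ʳ : ∀ {k E E′ X} d → (∀ h → E h * d ≈ E′ h) →
                    IsSolution k E X → IsSolution k E′ (λ h → X h * d)
    IsSolution-*ʳ {k} {E} {E′} {X} d E*d≈E′ (equation , boundary) =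
      equation′ , trans (*-congʳ boundary) (zeroˡ d)
      where
      Xd : ℕ → Carrier
      Xd h = X h * d

      prev-*ʳ : ∀ h → prev X h * d ≈ prev Xd h
      prev-*ʳ zero    = zeroˡ d
      prev-*ʳ (suc h) = refl

      equation′ : ∀ h → h ≤ k → Xd h ≈ x * Xd (suc h) + (B h * Xd h + (A h * prev Xd h + E′ h))
      equation′ h h≤k = begin
        X h * d
          ≈⟨ *-congʳ (equation h h≤k) ⟩
        (x * X (suc h) + (B h * X h + (A h * prev X h + E h))) * d
          ≈⟨ solve 8 (λ x′ u b v a w e d′ → (x′ :* u :+ (b :* v :+ (a :* w :+ e))) :* d′
                                 := x′ :* (u :* d′) :+ (b :* (v :* d′) :+ (a :* (w :* d′) :+ e :* d′)))
               refl x (X (suc h)) (B h) (X h) (A h) (prev X h) (E h) d ⟩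
        x * Xd (suc h) + (B h * Xd h + (A h * (prev X h * d) + E h * d))
          ≈⟨ +-congˡ (+-congˡ (+-cong (*-congˡ (prev-*ʳ h)) (E*d≈E′ h))) ⟩
        x * Xd (suc h) + (B h * Xd h + (A h * prev Xd h + E′ h)) ∎

    ∏A : ℕ → ℕ → Carrier
    ∏A s zero    = 1#
    ∏A s (suc m) = ∏A s m * A (s +ℕ suc m)

    module Candidate (K : ℕ → ℕ → Carrier) (K-cont : ∀ j → IsContinuant B C j (K j))
                     {k t : ℕ} (t≤k : t ≤ k) where
      open Splitting B C K K-cont

      Q : ℕ → Carrier
      Q = K 0

      V : ℕ → Carrier
      V h = K (suc h) (k ∸ h)

      Π : ℕ → Carrier
      Π h = ∏A t (h ∸ t)

      -- The claimed generating functions, multiplied by P*_{k+1}.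
      H : ℕ → Carrier
      H h with h ≤? k
      ... | no  _ = 0#
      ... | yes _ with h ≤? t
      ...   | yes _ = (Q h * V t) * x ^ (t ∸ h)
      ...   | no  _ = (Q t * V h) * Π h

      H-below : ∀ {h} → h ≤ t → H h ≈ (Q h * V t) * x ^ (t ∸ h)
      H-below {h} h≤t with h ≤? k
      ... | no  h≰k = ⊥-elim (h≰k (ℕ.≤-trans h≤t t≤k))
      ... | yes _ with h ≤? t
      ...   | yes _   = refl
      ...   | no  h≰t = ⊥-elim (h≰t h≤t)

      H-strictly-above : ∀ {h} → t < h → h ≤ k → H h ≈ (Q t * V h) * Π h
      H-strictly-above {h} t<h h≤k with h ≤? k
      ... | no  h≰k = ⊥-elim (h≰k h≤k)
      ... | yes _ with h ≤? t
      ...   | yes h≤t = ⊥-elim (ℕ.<⇒≱ t<h h≤t)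
      ...   | no  _   = refl

      H-beyond : ∀ {h} → k < h → H h ≈ 0#
      H-beyond {h} k<h with h ≤? k
      ... | no  _   = refl
      ... | yes h≤k = ⊥-elim (ℕ.<⇒≱ k<h h≤k)

      x^[t∸t]≈1 : x ^ (t ∸ t) ≈ 1#
      x^[t∸t]≈1 = reflexive (≡.cong (x ^_) (ℕ.n∸n≡0 t))

      Π-at : Π t ≈ 1#
      Π-at = reflexive (≡.cong (∏A t) (ℕ.n∸n≡0 t))

      Π-suc : ∀ {h} → t ≤ h → Π (suc h) ≈ Π h * A (suc h)
      Π-suc {h} t≤h = reflexive (≡.trans (≡.cong (∏A t) (ℕ.+-∸-assoc 1 t≤h))
        (≡.cong (λ i → Π h * A i) (≡.trans (ℕ.+-suc t (h ∸ t)) (≡.cong suc (ℕ.m+[n∸m]≡n t≤h)))))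

      H-at : H t ≈ Q t * V t
      H-at = trans (H-below ℕ.≤-refl) (trans (*-congˡ x^[t∸t]≈1) (*-identityʳ _))

      H-above : ∀ {h} → t ≤ h → h ≤ k → H h ≈ (Q t * V h) * Π h
      H-above t≤h h≤k with ℕ.m≤n⇒m<n∨m≡n t≤h
      ... | inj₁ t<h    = H-strictly-above t<h h≤k
      ... | inj₂ ≡.refl = trans H-at (sym (trans (*-congˡ Π-at) (*-identityʳ _)))

      prevH-below : ∀ {h} → h ≤ t → prev H h ≈ (prev Q h * V t) * x ^ suc (t ∸ h)
      prevH-below {zero}  _   = sym (trans (*-congʳ (zeroˡ _)) (zeroˡ _))
      prevH-below {suc h} h<t =
        trans (H-below (ℕ.<⇒≤ h<t)) (*-congˡ (reflexive (≡.cong (x ^_) (ℕ.+-∸-assoc 1 h<t))))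

      x*H-next : ∀ {h} → t ≤ h → h ≤ k →
                 x * H (suc h) ≈ (Q t * Π h) * (C (suc h) * prev (K (suc (suc h))) (k ∸ h))
      x*H-next {h} t≤h h≤k with ℕ.m≤n⇒m<n∨m≡n h≤k
      ... | inj₁ h<k = begin
        x * H (suc h)
          ≈⟨ *-congˡ (trans (H-above (ℕ.m≤n⇒m≤1+n t≤h) h<k) (*-congˡ (Π-suc t≤h))) ⟩
        x * ((Q t * V (suc h)) * (Π h * A (suc h)))
          ≈⟨ solve 5 (λ x′ q v p a → x′ :* ((q :* v) :* (p :* a)) := (q :* p) :* ((a :* x′) :* v))
               refl x (Q t) (V (suc h)) (Π h) (A (suc h)) ⟩
        (Q t * Π h) * (C (suc h) * V (suc h))
          ≈⟨ *-congˡ (*-congˡ (reflexive (≡.cong (prev (K (suc (suc h)))) (≡.sym (ℕ.+-∸-assoc 1 h<k))))) ⟩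
        (Q t * Π h) * (C (suc h) * prev (K (suc (suc h))) (k ∸ h)) ∎
      ... | inj₂ ≡.refl = begin
        x * H (suc h)
          ≈⟨ trans (*-congˡ (H-beyond ℕ.≤-refl)) (zeroʳ x) ⟩
        0#
          ≈⟨ solve 2 (λ p c → con 0 := p :* (c :* con 0)) refl (Q t * Π h) (C (suc h)) ⟩
        (Q t * Π h) * (C (suc h) * 0#)
          ≈⟨ *-congˡ (*-congˡ (reflexive (≡.cong (prev (K (suc (suc h)))) (≡.sym (ℕ.n∸n≡0 h))))) ⟩
        (Q t * Π h) * (C (suc h) * prev (K (suc (suc h))) (h ∸ h)) ∎

      RHS : ℕ → Carrier
      RHS h = x * H (suc h) + (B h * H h + (A h * prev H h + single t (Q (suc k)) h))

      solves-below : ∀ {h} → h < t → H h ≈ RHS h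
      solves-below {h} h<t = sym (begin
        RHS h
          ≈⟨ +-cong (*-congˡ (H-below h<t))
                    (+-cong (*-congˡ H-h)
                            (+-cong (*-congˡ (trans (prevH-below (ℕ.<⇒≤ h<t)) (*-congˡ (*-congˡ x^[t∸h]))))
                                    (single-other _ (ℕ.<⇒≢ h<t)))) ⟩
        x * ((Q (suc h) * V t) * y) + (B h * ((Q h * V t) * (x * y)) + (A h * ((prev Q h * V t) * (x * (x * y))) + 0#))
          ≈⟨ solve 8 (λ x′ q₁ v y′ b q₀ a q₋ →
                 x′ :* ((q₁ :* v) :* y′) :+ (b :* ((q₀ :* v) :* (x′ :* y′)) :+ (a :* ((q₋ :* v) :* (x′ :* (x′ :* y′))) :+ con 0))
                   := ((q₁ :+ (b :* q₀ :+ (a :* x′) :* q₋)) :* v) :* (x′ :* y′))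
               refl x (Q (suc h)) (V t) y (B h) (Q h) (A h) (prev Q h) ⟩
        ((Q (suc h) + (B h * Q h + C h * prev Q h)) * V t) * (x * y)
          ≈⟨ *-congʳ (*-congʳ (K-recurrence 0 h)) ⟩
        (Q h * V t) * (x * y)
          ≈⟨ sym H-h ⟩
        H h ∎)
        where
        y = x ^ (t ∸ suc h)
        x^[t∸h] : x ^ (t ∸ h) ≈ x * y
        x^[t∸h] = reflexive (≡.cong (x ^_) (ℕ.+-∸-assoc 1 h<t))
        H-h : H h ≈ (Q h * V t) * (x * y)
        H-h = trans (H-below (ℕ.<⇒≤ h<t)) (*-congˡ x^[t∸h])

      solves-at : H t ≈ RHS t
      solves-at = sym (begin
        RHS t
          ≈⟨ +-cong (trans (x*H-next ℕ.≤-refl t≤k) (*-congʳ (trans (*-congˡ Π-at) (*-identityʳ _))))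
                    (+-cong (*-congˡ H-at)
                            (+-cong (*-congˡ prevH-at) (single-self t _))) ⟩
        Q t * (C (suc t) * T) + (B t * (Q t * V t) + (A t * ((prev Q t * V t) * x) + Q (suc k)))
          ≈⟨ solve 9 (λ q c τ b v a q₋ x′ q′ →
                 q :* (c :* τ) :+ (b :* (q :* v) :+ (a :* ((q₋ :* v) :* x′) :+ q′))
                   := (q′ :+ (c :* q) :* τ) :+ (b :* q :+ (a :* x′) :* q₋) :* v)
               refl (Q t) (C (suc t)) T (B t) (V t) (A t) (prev Q t) x (Q (suc k)) ⟩
        (Q (suc k) + (C (suc t) * Q t) * T) + (B t * Q t + C t * prev Q t) * V t
          ≈⟨ +-congʳ (trans (+-congʳ (reflexive (≡.cong Q k+1≡[k∸t]+[t+1])))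
                            (splitting 0 t (suc t) ≡.refl (k ∸ t))) ⟩
        Q (suc t) * V t + (B t * Q t + C t * prev Q t) * V t
          ≈⟨ sym (distribʳ (V t) _ _) ⟩
        (Q (suc t) + (B t * Q t + C t * prev Q t)) * V t
          ≈⟨ *-congʳ (K-recurrence 0 t) ⟩
        Q t * V t
          ≈⟨ sym H-at ⟩
        H t ∎)
        where
        T = prev (K (suc (suc t))) (k ∸ t)
        prevH-at : prev H t ≈ (prev Q t * V t) * x
        prevH-at = trans (prevH-below ℕ.≤-refl) (*-congˡ (trans (*-congˡ x^[t∸t]≈1) (*-identityʳ x)))
        k+1≡[k∸t]+[t+1] : suc k ≡ (k ∸ t) +ℕ suc t
        k+1≡[k∸t]+[t+1] = ≡.sym (≡.trans (ℕ.+-suc (k ∸ t) t) (≡.cong suc (ℕ.m∸n+n≡m t≤k)))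

      solves-above : ∀ {h} → t < h → h ≤ k → H h ≈ RHS h
      solves-above {suc h} (s≤s t≤h) 1+h≤k = sym (begin
        RHS (suc h)
          ≈⟨ +-cong (trans (x*H-next (ℕ.m≤n⇒m≤1+n t≤h) 1+h≤k) (*-congʳ (*-congˡ (Π-suc t≤h))))
                    (+-cong (*-congˡ H-h)
                            (+-cong (*-congˡ (H-above t≤h (ℕ.<⇒≤ 1+h≤k)))
                                    (single-other _ (ℕ.>⇒≢ (s≤s t≤h))))) ⟩
        (Q t * (Π h * a)) * (C (suc (suc h)) * T) + (B (suc h) * ((Q t * V (suc h)) * (Π h * a)) + (a * ((Q t * V h) * Π h) + 0#))
          ≈⟨ solve 8 (λ q p a′ c τ b v v′ →
                 (q :* (p :* a′)) :* (c :* τ) :+ (b :* ((q :* v) :* (p :* a′)) :+ (a′ :* ((q :* v′) :* p) :+ con 0))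
                   := (q :* (p :* a′)) :* ((v′ :+ c :* τ) :+ b :* v))
               refl (Q t) (Π h) a (C (suc (suc h))) T (B (suc h)) (V (suc h)) (V h) ⟩
        (Q t * (Π h * a)) * ((V h + C (suc (suc h)) * T) + B (suc h) * V (suc h))
          ≈⟨ *-congˡ (+-congʳ (trans (+-congʳ (reflexive (≡.cong (K (suc h)) (ℕ.+-∸-assoc 1 1+h≤k))))
                                     (splitting-bottom (suc h) (k ∸ suc h)))) ⟩
        (Q t * (Π h * a)) * (K (suc h) 1 * V (suc h) + B (suc h) * V (suc h))
          ≈⟨ solve 6 (λ q p a′ u v b → (q :* (p :* a′)) :* (u :* v :+ b :* v) := ((q :* v) :* (p :* a′)) :* (u :+ b))
               refl (Q t) (Π h) a (K (suc h) 1) (V (suc h)) (B (suc h)) ⟩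
        ((Q t * V (suc h)) * (Π h * a)) * (K (suc h) 1 + B (suc h))
          ≈⟨ trans (*-congˡ (K-one (suc h))) (*-identityʳ _) ⟩
        (Q t * V (suc h)) * (Π h * a)
          ≈⟨ sym H-h ⟩
        H (suc h) ∎)
        where
        a = A (suc h)
        T = prev (K (suc (suc (suc h)))) (k ∸ suc h)
        H-h : H (suc h) ≈ (Q t * V (suc h)) * (Π h * a)
        H-h = trans (H-strictly-above (s≤s t≤h) 1+h≤k) (*-congˡ (Π-suc t≤h))

      candidate-solves : IsSolution k (single t (Q (suc k))) H
      candidate-solves = equation , H-beyond ℕ.≤-refl
        where
        equation : ∀ h → h ≤ k → H h ≈ RHS h
        equation h h≤k with ℕ.<-cmp h t
        ... | tri< h<t _ _      = solves-below h<t
        ... | tri≈ _ ≡.refl _   = solves-at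
        ... | tri> _ _ t<h      = solves-above t<h h≤k

module PowerSeries {c ℓ} (R : CommutativeRing c ℓ) where
  open CommutativeRing R hiding (zero)
  open Series R
  open import Relation.Binary.Reasoning.Setoid setoid
  open import Algebra.Solver.Ring.NaturalCoefficients.Default commutativeSemiring

  tail : Seq → Seq
  tail f n = f (suc n)

  sumBelow-cong : ∀ n {f g} → (∀ i → i < n → f i ≈ g i) → sumBelow n f ≈ sumBelow n g
  sumBelow-cong zero    f≈g = refl
  sumBelow-cong (suc n) f≈g = +-cong (sumBelow-cong n (λ i i<n → f≈g i (ℕ.m≤n⇒m≤1+n i<n))) (f≈g n ℕ.≤-refl)

  sumBelow-+ : ∀ n f g → sumBelow n (λ i → f i + g i) ≈ sumBelow n f + sumBelow n g
  sumBelow-+ zero    f g = sym (+-identityˡ 0#)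
  sumBelow-+ (suc n) f g = begin
    sumBelow n (λ i → f i + g i) + (f n + g n)  ≈⟨ +-congʳ (sumBelow-+ n f g) ⟩
    (sumBelow n f + sumBelow n g) + (f n + g n)
      ≈⟨ solve 4 (λ s t u v → (s :+ t) :+ (u :+ v) := (s :+ u) :+ (t :+ v)) refl (sumBelow n f) (sumBelow n g) (f n) (g n) ⟩
    (sumBelow n f + f n) + (sumBelow n g + g n) ∎

  sumBelow-*ˡ : ∀ n d f → sumBelow n (λ i → d * f i) ≈ d * sumBelow n f
  sumBelow-*ˡ zero    d f = sym (zeroʳ d)
  sumBelow-*ˡ (suc n) d f = trans (+-congʳ (sumBelow-*ˡ n d f)) (sym (distribˡ d _ _))

  sumBelow-suc : ∀ n f → sumBelow (suc n) f ≈ f 0 + sumBelow n (λ i → f (suc i))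
  sumBelow-suc zero    f = +-comm 0# (f 0)
  sumBelow-suc (suc n) f = trans (+-congʳ (sumBelow-suc n f)) (+-assoc _ _ _)

  ⋆-coeff₀ : ∀ f g → (f ⋆ g) 0 ≈ f 0 * g 0
  ⋆-coeff₀ f g = +-identityˡ _

  ⋆-coeff-suc : ∀ f g n → (f ⋆ g) (suc n) ≈ f 0 * g (suc n) + (tail f ⋆ g) n
  ⋆-coeff-suc f g n = sumBelow-suc (suc n) (λ i → f i * g (suc n ∸ i))

  ⋆-cong : ∀ {f f′ g g′} → f ≋ f′ → g ≋ g′ → (f ⋆ g) ≋ (f′ ⋆ g′)
  ⋆-cong f≋f′ g≋g′ n = sumBelow-cong (suc n) (λ i _ → *-cong (f≋f′ i) (g≋g′ (n ∸ i)))

  ⋆-zeroˡ : ∀ f g → f ≋ zeroS → (f ⋆ g) ≋ zeroS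
  ⋆-zeroˡ f g f≋0 zero    = trans (⋆-coeff₀ f g) (trans (*-congʳ (f≋0 0)) (zeroˡ _))
  ⋆-zeroˡ f g f≋0 (suc n) = begin
    (f ⋆ g) (suc n)                ≈⟨ ⋆-coeff-suc f g n ⟩
    f 0 * g (suc n) + (tail f ⋆ g) n
      ≈⟨ +-cong (trans (*-congʳ (f≋0 0)) (zeroˡ _)) (⋆-zeroˡ (tail f) g (λ i → f≋0 (suc i)) n) ⟩
    0# + 0#                        ≈⟨ +-identityˡ 0# ⟩
    0# ∎

  ⋆-distribʳ : ∀ h f g → ((f ⊕ g) ⋆ h) ≋ ((f ⋆ h) ⊕ (g ⋆ h))
  ⋆-distribʳ h f g n =
    trans (sumBelow-cong (suc n) (λ i _ → distribʳ (h (n ∸ i)) (f i) (g i)))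
          (sumBelow-+ (suc n) (λ i → f i * h (n ∸ i)) (λ i → g i * h (n ∸ i)))

  scale-⋆ : ∀ d f g → (scale d f ⋆ g) ≋ scale d (f ⋆ g)
  scale-⋆ d f g n =
    trans (sumBelow-cong (suc n) (λ i _ → *-assoc d (f i) (g (n ∸ i))))
          (sumBelow-*ˡ (suc n) d (λ i → f i * g (n ∸ i)))

  ⋆-identityˡ : ∀ g → (oneS ⋆ g) ≋ g
  ⋆-identityˡ g zero    = trans (⋆-coeff₀ oneS g) (*-identityˡ _)
  ⋆-identityˡ g (suc n) = begin
    (oneS ⋆ g) (suc n)                 ≈⟨ ⋆-coeff-suc oneS g n ⟩
    1# * g (suc n) + (tail oneS ⋆ g) n  ≈⟨ +-cong (*-identityˡ _) (⋆-zeroˡ (tail oneS) g (λ _ → refl) n) ⟩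
    g (suc n) + 0#                     ≈⟨ +-identityʳ _ ⟩
    g (suc n) ∎

  ⋆-comm : ∀ f g → (f ⋆ g) ≋ (g ⋆ f)
  ⋆-comm f g zero = +-congˡ (*-comm (f 0) (g 0))
  ⋆-comm f g (suc zero) = begin
    (f ⋆ g) 1                  ≈⟨ ⋆-coeff-suc f g 0 ⟩
    f 0 * g 1 + (tail f ⋆ g) 0 ≈⟨ +-congˡ (⋆-coeff₀ (tail f) g) ⟩
    f 0 * g 1 + f 1 * g 0
      ≈⟨ solve 4 (λ p q r s → p :* q :+ r :* s := s :* r :+ q :* p) refl (f 0) (g 1) (f 1) (g 0) ⟩
    g 0 * f 1 + g 1 * f 0      ≈⟨ +-congˡ (sym (⋆-coeff₀ (tail g) f)) ⟩
    g 0 * f 1 + (tail g ⋆ f) 0 ≈⟨ sym (⋆-coeff-suc g f 0) ⟩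
    (g ⋆ f) 1 ∎
  ⋆-comm f g (suc (suc n)) = begin
    (f ⋆ g) (2+ n)
      ≈⟨ ⋆-coeff-suc f g (suc n) ⟩
    f 0 * g (2+ n) + (tail f ⋆ g) (suc n)
      ≈⟨ +-congˡ (trans (⋆-comm (tail f) g (suc n)) (⋆-coeff-suc g (tail f) n)) ⟩
    f 0 * g (2+ n) + (g 0 * f (2+ n) + (tail g ⋆ tail f) n)
      ≈⟨ +-congˡ (+-congˡ (⋆-comm (tail g) (tail f) n)) ⟩
    f 0 * g (2+ n) + (g 0 * f (2+ n) + (tail f ⋆ tail g) n)
      ≈⟨ solve 5 (λ p q r s t → p :* q :+ (r :* s :+ t) := r :* s :+ (p :* q :+ t)) refl
           (f 0) (g (2+ n)) (g 0) (f (2+ n)) ((tail f ⋆ tail g) n) ⟩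
    g 0 * f (2+ n) + (f 0 * g (2+ n) + (tail f ⋆ tail g) n)
      ≈⟨ +-congˡ (trans (sym (⋆-coeff-suc f (tail g) n)) (⋆-comm f (tail g) (suc n))) ⟩
    g 0 * f (2+ n) + (tail g ⋆ f) (suc n)
      ≈⟨ sym (⋆-coeff-suc g f (suc n)) ⟩
    (g ⋆ f) (2+ n) ∎
    where 2+_ = λ m → suc (suc m)

  ⋆-assoc : ∀ f g h → ((f ⋆ g) ⋆ h) ≋ (f ⋆ (g ⋆ h))
  ⋆-assoc f g h zero = begin
    ((f ⋆ g) ⋆ h) 0     ≈⟨ trans (⋆-coeff₀ (f ⋆ g) h) (*-congʳ (⋆-coeff₀ f g)) ⟩
    (f 0 * g 0) * h 0   ≈⟨ *-assoc _ _ _ ⟩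
    f 0 * (g 0 * h 0)   ≈⟨ sym (trans (⋆-coeff₀ f (g ⋆ h)) (*-congˡ (⋆-coeff₀ g h))) ⟩
    (f ⋆ (g ⋆ h)) 0 ∎
  ⋆-assoc f g h (suc n) = begin
    ((f ⋆ g) ⋆ h) (suc n)
      ≈⟨ ⋆-coeff-suc (f ⋆ g) h n ⟩
    (f ⋆ g) 0 * h (suc n) + (tail (f ⋆ g) ⋆ h) n
      ≈⟨ +-cong (*-congʳ (⋆-coeff₀ f g)) (⋆-cong {g = h} (⋆-coeff-suc f g) (λ _ → refl) n) ⟩
    (f 0 * g 0) * h (suc n) + ((scale (f 0) (tail g) ⊕ (tail f ⋆ g)) ⋆ h) n
      ≈⟨ +-congˡ (trans (⋆-distribʳ h (scale (f 0) (tail g)) (tail f ⋆ g) n)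
                        (+-cong (scale-⋆ (f 0) (tail g) h n) (⋆-assoc (tail f) g h n))) ⟩
    (f 0 * g 0) * h (suc n) + (f 0 * (tail g ⋆ h) n + (tail f ⋆ (g ⋆ h)) n)
      ≈⟨ solve 5 (λ p q r s t → (p :* q) :* r :+ (p :* s :+ t) := p :* (q :* r :+ s) :+ t) refl
           (f 0) (g 0) (h (suc n)) ((tail g ⋆ h) n) ((tail f ⋆ (g ⋆ h)) n) ⟩
    f 0 * (g 0 * h (suc n) + (tail g ⋆ h) n) + (tail f ⋆ (g ⋆ h)) n
      ≈⟨ +-congʳ (*-congˡ (sym (⋆-coeff-suc g h n))) ⟩
    f 0 * (g ⋆ h) (suc n) + (tail f ⋆ (g ⋆ h)) n
      ≈⟨ sym (⋆-coeff-suc f (g ⋆ h) n) ⟩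
    (f ⋆ (g ⋆ h)) (suc n) ∎

  seriesRing : CommutativeRing c ℓ
  seriesRing = record
    { Carrier = Seq
    ; _≈_ = _≋_
    ; _+_ = _⊕_
    ; _*_ = _⋆_
    ; -_ = λ f n → - f n
    ; 0# = zeroS
    ; 1# = oneS
    ; isCommutativeRing = record
      { isRing = record
        { +-isAbelianGroup = Pointwise.isAbelianGroup ℕ +-isAbelianGroup
        ; *-cong = ⋆-cong
        ; *-assoc = ⋆-assoc
        ; *-identity = ⋆-identityˡ , λ f n → trans (⋆-comm f oneS n) (⋆-identityˡ f n)
        ; distrib = (λ h f g n → trans (⋆-comm h (f ⊕ g) n)
                                       (trans (⋆-distribʳ h f g n) (+-cong (⋆-comm f h n) (⋆-comm g h n))))
                  , ⋆-distribʳ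
        }
      ; *-comm = ⋆-comm
      }
    }

  x : Seq
  x = linS 0# 1#

  tail-linS : ∀ c₀ c₁ → tail (linS c₀ c₁) ≋ linS c₁ 0#
  tail-linS c₀ c₁ zero          = refl
  tail-linS c₀ c₁ (suc zero)    = refl
  tail-linS c₀ c₁ (suc (suc n)) = refl

  linS-⋆ : ∀ c₀ c₁ g n → (linS c₀ c₁ ⋆ g) n ≈ c₀ * g n + c₁ * xTimes g n
  linS-⋆ c₀ c₁ g zero = begin
    (linS c₀ c₁ ⋆ g) 0   ≈⟨ ⋆-coeff₀ (linS c₀ c₁) g ⟩
    c₀ * g 0             ≈⟨ solve 2 (λ p q → p := p :+ q :* con 0) refl (c₀ * g 0) c₁ ⟩
    c₀ * g 0 + c₁ * 0#   ∎
  linS-⋆ c₀ c₁ g (suc n) = begin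
    (linS c₀ c₁ ⋆ g) (suc n)                     ≈⟨ ⋆-coeff-suc (linS c₀ c₁) g n ⟩
    c₀ * g (suc n) + (tail (linS c₀ c₁) ⋆ g) n    ≈⟨ +-congˡ (⋆-cong {g = g} (tail-linS c₀ c₁) (λ _ → refl) n) ⟩
    c₀ * g (suc n) + (linS c₁ 0# ⋆ g) n           ≈⟨ +-congˡ (linS-⋆ c₁ 0# g n) ⟩
    c₀ * g (suc n) + (c₁ * g n + 0# * xTimes g n) ≈⟨ +-congˡ (trans (+-congˡ (zeroˡ _)) (+-identityʳ _)) ⟩
    c₀ * g (suc n) + c₁ * g n                    ∎

  x⋆≋xTimes : ∀ g → (x ⋆ g) ≋ xTimes g
  x⋆≋xTimes g n = trans (linS-⋆ 0# 1# g n) (trans (+-cong (zeroˡ _) (*-identityˡ _)) (+-identityˡ _))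

  xPow-suc : ∀ m n → xPow (suc m) (suc n) ≈ xPow m n
  xPow-suc m n with m ≟ n | suc m ≟ suc n
  ... | yes _   | yes _   = refl
  ... | no  _   | no  _   = refl
  ... | yes m≡n | no m≢n  = ⊥-elim (m≢n (≡.cong suc m≡n))
  ... | no  m≢n | yes m≡n = ⊥-elim (m≢n (ℕ.suc-injective m≡n))

  open import Algebra.Definitions.RawSemiring (Semiring.rawSemiring (CommutativeRing.semiring seriesRing)) using (_^_)

  xPow≋x^ : ∀ m → xPow m ≋ (x ^ m)
  xPow≋x^ zero    n       = refl
  xPow≋x^ (suc m) zero    = sym (x⋆≋xTimes (x ^ m) 0)
  xPow≋x^ (suc m) (suc n) = trans (xPow-suc m n) (trans (xPow≋x^ m n) (sym (x⋆≋xTimes (x ^ m) (suc n))))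

  nth-invList : ∀ f n i → i ≤ n → nth (invList f n) i ≡ inv f (n ∸ i)
  nth-invList f n       zero    _         = ≡.refl
  nth-invList f (suc n) (suc i) (s≤s i≤n) = nth-invList f n i i≤n

  inv-suc : ∀ f n → inv f (suc n) ≈ - (tail f ⋆ inv f) n
  inv-suc f n = -‿cong (sumBelow-cong (suc n) (λ i i≤n → *-congˡ (reflexive (nth-invList f n i (ℕ.≤-pred i≤n)))))

  ⋆-inverseʳ : ∀ f → f 0 ≈ 1# → (f ⋆ inv f) ≋ oneS
  ⋆-inverseʳ f f₀≈1 zero    = trans (⋆-coeff₀ f (inv f)) (trans (*-congʳ f₀≈1) (*-identityˡ 1#))
  ⋆-inverseʳ f f₀≈1 (suc n) = begin
    (f ⋆ inv f) (suc n)                             ≈⟨ ⋆-coeff-suc f (inv f) n ⟩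
    f 0 * inv f (suc n) + (tail f ⋆ inv f) n        ≈⟨ +-congʳ (*-cong f₀≈1 (inv-suc f n)) ⟩
    1# * - (tail f ⋆ inv f) n + (tail f ⋆ inv f) n  ≈⟨ +-congʳ (*-identityˡ _) ⟩
    - (tail f ⋆ inv f) n + (tail f ⋆ inv f) n       ≈⟨ -‿inverseˡ _ ⟩
    0# ∎

  xTimes-cong : ∀ {f g} → f ≋ g → xTimes f ≋ xTimes g
  xTimes-cong f≋g zero    = refl
  xTimes-cong f≋g (suc n) = f≋g n

  linS₀-⋆ : ∀ d g n → (linS 0# d ⋆ g) n ≈ d * xTimes g n
  linS₀-⋆ d g n = trans (linS-⋆ 0# d g n) (trans (+-congʳ (zeroˡ _)) (+-identityˡ _))

  linS⋆x-⋆ : ∀ c₀ c₁ g n → ((linS c₀ c₁ ⋆ x) ⋆ g) n ≈ c₀ * xTimes g n + c₁ * xTimes (xTimes g) n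
  linS⋆x-⋆ c₀ c₁ g n = begin
    ((linS c₀ c₁ ⋆ x) ⋆ g) n              ≈⟨ ⋆-assoc (linS c₀ c₁) x g n ⟩
    (linS c₀ c₁ ⋆ (x ⋆ g)) n              ≈⟨ linS-⋆ c₀ c₁ (x ⋆ g) n ⟩
    c₀ * (x ⋆ g) n + c₁ * xTimes (x ⋆ g) n
      ≈⟨ +-cong (*-congˡ (x⋆≋xTimes g n)) (*-congˡ (xTimes-cong (x⋆≋xTimes g) n)) ⟩
    c₀ * xTimes g n + c₁ * xTimes (xTimes g) n ∎

module PstarRecurrence {c ℓ} (R : CommutativeRing c ℓ) where
  open CommutativeRing R hiding (zero)
  open Series R
  open PowerSeries R
  open Continuants seriesRing using (prev; IsContinuant)
  open import Relation.Binary.Reasoning.Setoid setoid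
  open import Algebra.Properties.AbelianGroup +-abelianGroup using (ε⁻¹≈ε; //-rightDividesˡ; ⁻¹-∙-comm)

  drop-vanishing : ∀ {u v w z β α λ′} → v ≈ 0# → w ≈ 0# → z ≈ 0# →
                   (u - β * v) - (α * w + λ′ * z) ≈ u
  drop-vanishing {u} {v} {w} {z} {β} {α} {λ′} v≈0 w≈0 z≈0 = begin
    (u - β * v) - (α * w + λ′ * z)
      ≈⟨ +-cong (+-congˡ (-‿cong (*-zero v≈0)))
                (-‿cong (trans (+-cong (*-zero w≈0) (*-zero z≈0)) (+-identityˡ 0#))) ⟩
    (u - 0#) - 0#                  ≈⟨ +-cong (trans (+-congˡ ε⁻¹≈ε) (+-identityʳ u)) ε⁻¹≈ε ⟩
    u + 0#                         ≈⟨ +-identityʳ u ⟩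
    u ∎
    where
    *-zero : ∀ {γ y} → y ≈ 0# → γ * y ≈ 0#
    *-zero y≈0 = trans (*-congˡ y≈0) (zeroʳ _)

  u-v-w+[v+w]≈u : ∀ u v w → ((u - v) - w) + (v + w) ≈ u
  u-v-w+[v+w]≈u u v w = begin
    ((u - v) - w) + (v + w)   ≈⟨ +-congʳ (trans (+-assoc u (- v) (- w)) (+-congˡ (⁻¹-∙-comm v w))) ⟩
    (u - (v + w)) + (v + w)   ≈⟨ //-rightDividesˡ (v + w) u ⟩
    u ∎

  rev : ℕ → Seq → Seq
  rev d f m with m ≤? d
  ... | yes _ = f (d ∸ m)
  ... | no  _ = 0#

  HasDegree≤ : ℕ → Seq → Set ℓ
  HasDegree≤ d f = ∀ j → d < j → f j ≈ 0#

  rev-xTimes : ∀ d f → rev (suc d) (xTimes f) ≋ rev d f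
  rev-xTimes d f m with m ≤? suc d | m ≤? d
  ... | yes _     | yes m≤d = reflexive (≡.cong (xTimes f) (ℕ.+-∸-assoc 1 m≤d))
  ... | yes _     | no  m≰d = reflexive (≡.cong (xTimes f) (ℕ.m≤n⇒m∸n≡0 (ℕ.≰⇒> m≰d)))
  ... | no  m≰1+d | yes m≤d = ⊥-elim (m≰1+d (ℕ.m≤n⇒m≤1+n m≤d))
  ... | no  _     | no  _   = refl

  rev-suc : ∀ {d f} → HasDegree≤ d f → rev (suc d) f ≋ xTimes (rev d f)
  rev-suc {d} deg zero = deg (suc d) ℕ.≤-refl
  rev-suc {d} deg (suc m) with suc m ≤? suc d | m ≤? d
  ... | yes _         | yes _   = refl
  ... | no  _         | no  _   = refl
  ... | yes 1+m≤1+d   | no  m≰d = ⊥-elim (m≰d (ℕ.≤-pred 1+m≤1+d))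
  ... | no  1+m≰1+d   | yes m≤d = ⊥-elim (1+m≰1+d (s≤s m≤d))

  rev-zeroS : ∀ d → rev d zeroS ≋ zeroS
  rev-zeroS d m with m ≤? d
  ... | yes _ = refl
  ... | no  _ = refl

  HasDegree≤-suc : ∀ {d f} → HasDegree≤ d f → HasDegree≤ (suc d) f
  HasDegree≤-suc deg j 1+d<j = deg j (ℕ.<-trans (ℕ.n<1+n _) 1+d<j)

  module _ (b a lam : Seq) where

    Pprev : ℕ → Seq
    Pprev n = proj₁ (PPair b a lam n)

    P-degree : ∀ n → HasDegree≤ n (Pprev n) × HasDegree≤ n (P b a lam n)
    P-degree zero    = (λ _ _ → refl) , λ { (suc j) _ → refl }
    P-degree (suc n) = HasDegree≤-suc (proj₂ IH) , λ
      { (suc j) (s≤s n<j) → trans (drop-vanishing (proj₂ IH (suc j) (ℕ.m<n⇒m<1+n n<j))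
                                                  (proj₁ IH j n<j)
                                                  (proj₁ IH (suc j) (ℕ.m<n⇒m<1+n n<j)))
                                  (proj₂ IH j n<j) }
      where IH = P-degree n

    Pstar≋rev : ∀ n → Pstar b a lam n ≋ rev n (P b a lam n)
    Pstar≋rev n m with m ≤? n
    ... | yes _ = refl
    ... | no  _ = refl

    rev-Pprev : ∀ n → rev n (Pprev n) ≋ xTimes (prev (Pstar b a lam) n)
    rev-Pprev zero    m       = trans (rev-zeroS 0 m) (sym (xTimes-zeroS m))
      where
      xTimes-zeroS : xTimes zeroS ≋ zeroS
      xTimes-zeroS zero    = refl
      xTimes-zeroS (suc _) = refl
    rev-Pprev (suc n) m = trans (rev-suc (proj₂ (P-degree n)) m) (xTimes-cong (λ j → sym (Pstar≋rev n j)) m)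

    rev-P-suc : ∀ n m → rev (suc n) (P b a lam (suc n)) m
      ≈ (rev (suc n) (xTimes (P b a lam n)) m - b n * rev (suc n) (P b a lam n) m)
        - (a n * rev (suc n) (xTimes (Pprev n)) m + lam n * rev (suc n) (Pprev n) m)
    rev-P-suc n m with m ≤? suc n
    ... | yes _ = refl
    ... | no  _ = sym (drop-vanishing refl refl refl)

    Pstar-suc : ∀ n m → let q = Pstar b a lam n ; p = prev (Pstar b a lam) n in
      Pstar b a lam (suc n) m ≈ (q m - b n * xTimes q m) - (a n * xTimes p m + lam n * xTimes (xTimes p) m)
    Pstar-suc n m = begin
      Pstar b a lam (suc n) m
        ≈⟨ Pstar≋rev (suc n) m ⟩
      rev (suc n) (P b a lam (suc n)) m
        ≈⟨ rev-P-suc n m ⟩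
      (rev (suc n) (xTimes Pₙ) m - b n * rev (suc n) Pₙ m)
        - (a n * rev (suc n) (xTimes Pₙ₋₁) m + lam n * rev (suc n) Pₙ₋₁ m)
        ≈⟨ +-cong (+-cong (rev-xTimes-Pₙ m) (-‿cong (*-congˡ (rev-Pₙ m))))
                  (-‿cong (+-cong (*-congˡ (rev-xTimes-Pₙ₋₁ m)) (*-congˡ (rev-Pₙ₋₁ m)))) ⟩
      (q m - b n * xTimes q m) - (a n * xTimes p m + lam n * xTimes (xTimes p) m) ∎
      where
      Pₙ   = P b a lam n
      Pₙ₋₁ = Pprev n
      q    = Pstar b a lam n
      p    = prev (Pstar b a lam) n
      rev-xTimes-Pₙ : rev (suc n) (xTimes Pₙ) ≋ q
      rev-xTimes-Pₙ j = trans (rev-xTimes n Pₙ j) (sym (Pstar≋rev n j))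
      rev-Pₙ : rev (suc n) Pₙ ≋ xTimes q
      rev-Pₙ j = trans (rev-suc (proj₂ (P-degree n)) j) (xTimes-cong (λ i → sym (Pstar≋rev n i)) j)
      rev-xTimes-Pₙ₋₁ : rev (suc n) (xTimes Pₙ₋₁) ≋ xTimes p
      rev-xTimes-Pₙ₋₁ j = trans (rev-xTimes n Pₙ₋₁ j) (rev-Pprev n j)
      rev-Pₙ₋₁ : rev (suc n) Pₙ₋₁ ≋ xTimes (xTimes p)
      rev-Pₙ₋₁ j = trans (rev-suc (proj₁ (P-degree n)) j) (xTimes-cong (rev-Pprev n) j)

    Pstar-constant : ∀ n → Pstar b a lam n 0 ≈ 1#
    Pstar-constant zero    = refl
    Pstar-constant (suc n) = trans (Pstar-suc n 0) (trans (drop-vanishing refl refl refl) (Pstar-constant n))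

    Pstar-isContinuant : IsContinuant (λ h → linS 0# (b h)) (λ h → linS (a h) (lam h) ⋆ x) 0 (Pstar b a lam)
    Pstar-isContinuant = Pstar-zero , recurrence
      where
      Pstar-zero : Pstar b a lam 0 ≋ oneS
      Pstar-zero zero    = refl
      Pstar-zero (suc m) = refl

      recurrence : ∀ n m → let q = Pstar b a lam n ; p = prev (Pstar b a lam) n in
        Pstar b a lam (suc n) m + ((linS 0# (b n) ⋆ q) m + ((linS (a n) (lam n) ⋆ x) ⋆ p) m) ≈ q m
      recurrence n m = trans (+-cong (Pstar-suc n m) (+-cong (linS₀-⋆ (b n) _ m) (linS⋆x-⋆ (a n) (lam n) _ m)))
                             (u-v-w+[v+w]≈u _ _ _)

module SeriesSystem {c ℓ} (R : CommutativeRing c ℓ) (b a lam : ℕ → CommutativeRing.Carrier R) where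
  open CommutativeRing R hiding (zero)
  open Series R
  open PowerSeries R
  open import Relation.Binary.Reasoning.Setoid setoid
  open Continuants seriesRing public using (prev; single; single-*ʳ; IsContinuant; module PathSystem)

  A : ℕ → Seq
  A h = linS (a h) (lam h)

  B : ℕ → Seq
  B h = linS 0# (b h)

  open PathSystem x A B public

  rhsCoeff : (X E : ℕ → Seq) → ℕ → ℕ → Carrier
  rhsCoeff X E h n =
    xTimes (X (suc h)) n + (b h * xTimes (X h) n + ((a h * prev X h n + lam h * xTimes (prev X h) n) + E h n))

  rhs≈rhsCoeff : ∀ X E h n →
    ((x ⋆ X (suc h)) ⊕ ((B h ⋆ X h) ⊕ ((A h ⋆ prev X h) ⊕ E h))) n ≈ rhsCoeff X E h n
  rhs≈rhsCoeff X E h n =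
    +-cong (x⋆≋xTimes _ n) (+-cong (linS₀-⋆ (b h) _ n) (+-congʳ (linS-⋆ (a h) (lam h) _ n)))

  solution-unique : ∀ {k E X Y} → IsSolution k E X → IsSolution k E Y → ∀ h → h ≤ k → X h ≋ Y h
  solution-unique {k} {E} {X} {Y} (X-eq , X-out) (Y-eq , Y-out) h h≤k n = agree n h (ℕ.m≤n⇒m≤1+n h≤k)
    where
    agree : ∀ n h → h ≤ suc k → X h n ≈ Y h n
    shifted : ∀ n h → h ≤ suc k → xTimes (X h) n ≈ xTimes (Y h) n
    previous : ∀ n h → h ≤ suc k → prev X h n ≈ prev Y h n
    shifted-previous : ∀ n h → h ≤ suc k → xTimes (prev X h) n ≈ xTimes (prev Y h) n

    agree n h h≤1+k with ℕ.m≤n⇒m<n∨m≡n h≤1+k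
    ... | inj₂ ≡.refl    = trans (X-out n) (sym (Y-out n))
    ... | inj₁ (s≤s h≤k) = begin
      X h n               ≈⟨ trans (X-eq h h≤k n) (rhs≈rhsCoeff X E h n) ⟩
      rhsCoeff X E h n   ≈⟨ +-cong (shifted n (suc h) (s≤s h≤k))
                                    (+-cong (*-congˡ (shifted n h h≤1+k))
                                            (+-congʳ (+-cong (*-congˡ (previous n h h≤1+k))
                                                             (*-congˡ (shifted-previous n h h≤1+k))))) ⟩
      rhsCoeff Y E h n   ≈⟨ sym (trans (Y-eq h h≤k n) (rhs≈rhsCoeff Y E h n)) ⟩
      Y h n ∎

    shifted zero    h _     = refl
    shifted (suc n) h h≤1+k = agree n h h≤1+k

    previous n zero    _     = refl
    previous n (suc h) h<1+k = agree n h (ℕ.<⇒≤ h<1+k)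

    shifted-previous zero    h _     = refl
    shifted-previous (suc n) h h≤1+k = previous n h h≤1+k

module Paths {c ℓ} (R : CommutativeRing c ℓ) (b a lam : ℕ → CommutativeRing.Carrier R) (k t : ℕ) where
  open CommutativeRing R hiding (zero)
  open Series R
  open SeriesSystem R b a lam
  open import Relation.Binary.Reasoning.Setoid setoid
  open import Algebra.Solver.Ring.NaturalCoefficients.Default commutativeSemiring

  total : ∀ {n h} → List (Path k n h t) → Carrier
  total ps = foldr _+_ 0# (map (weight b a lam) ps)

  total-++ : ∀ {n h} (ps qs : List (Path k n h t)) → total (ps ++ qs) ≈ total ps + total qs
  total-++ []       qs = sym (+-identityˡ _)
  total-++ (p ∷ ps) qs = trans (+-congˡ (total-++ ps qs)) (sym (+-assoc _ _ _))

  total-up : ∀ {n h} (h≤k : h ≤ k) (ps : List (Path k n (suc h) t)) → total (map (up h≤k) ps) ≈ total ps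
  total-up h≤k []       = refl
  total-up h≤k (p ∷ ps) = +-congˡ (total-up h≤k ps)

  total-map : ∀ {n h n′ h′} (f : Path k n h t → Path k n′ h′ t) d →
              (∀ p → weight b a lam (f p) ≡ d * weight b a lam p) → ∀ ps → total (map f ps) ≈ d * total ps
  total-map f d w≡ []       = sym (zeroʳ d)
  total-map f d w≡ (p ∷ ps) = trans (+-cong (reflexive (w≡ p)) (total-map f d w≡ ps)) (sym (distribˡ d _ _))

  total-guard : ∀ {n h m} (m≤?k : Dec (m ≤ k)) (f : m ≤ k → List (Path k n h t)) {v} →
                m ≤ k → (∀ m≤k → total (f m≤k) ≈ v) → total (guard m≤?k f) ≈ v
  total-guard (yes m≤k) f _   total≈v = total≈v m≤k
  total-guard (no  m≰k) f m≤k _       = ⊥-elim (m≰k m≤k)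

  total-guard-out : ∀ {n h m} (m≤?k : Dec (m ≤ k)) (f : m ≤ k → List (Path k n h t)) →
                    ¬ m ≤ k → total (guard m≤?k f) ≈ 0#
  total-guard-out (yes m≤k) f m≰k = ⊥-elim (m≰k m≤k)
  total-guard-out (no  _)   f _   = refl

  total-done : ∀ {h} → h ≤ k → total (doneCase k h t) ≈ single t oneS h 0
  total-done {h} h≤k with h ≟ t
  ... | yes ≡.refl = total-guard (h ≤? k) _ h≤k (λ _ → +-identityʳ 1#)
  ... | no  _      = refl

  total-done-out : ∀ {h} → ¬ h ≤ k → total (doneCase k h t) ≈ 0#
  total-done-out {h} h≰k with h ≟ t
  ... | yes ≡.refl = total-guard-out (h ≤? k) _ h≰k
  ... | no  _      = refl

  single-suc : ∀ h n → single t oneS h (suc n) ≈ 0#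
  single-suc h n with h ≟ t
  ... | yes _ = refl
  ... | no  _ = refl

  F : ℕ → Seq
  F h n = μ b a lam k n h t

  F-beyond : F (suc k) ≋ zeroS
  F-beyond zero    = trans (total-++ (doneCase k (suc k) t) _)
                           (trans (+-cong (total-done-out (ℕ.n≮n k)) (total-guard-out (suc k ≤? k) _ (ℕ.n≮n k)))
                                  (+-identityˡ 0#))
  F-beyond (suc n) = total-guard-out (suc k ≤? k) _ (ℕ.n≮n k)

  F-first-step : ∀ h n → h ≤ k → F h n ≈ rhsCoeff F (single t oneS) h n
  F-first-step zero zero h≤k = begin
    total (doneCase k 0 t)  ≈⟨ total-done h≤k ⟩
    e                       ≈⟨ solve 4 (λ e b′ a′ l′ → e := con 0 :+ (b′ :* con 0 :+ ((a′ :* con 0 :+ l′ :* con 0) :+ e)))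
                                 refl e (b 0) (a 0) (lam 0) ⟩
    rhsCoeff F E 0 0 ∎
    where E = single t oneS ; e = E 0 0
  F-first-step (suc h) zero h≤k = begin
    total (doneCase k (suc h) t ++ _)
      ≈⟨ total-++ (doneCase k (suc h) t) _ ⟩
    total (doneCase k (suc h) t) + total (guard (suc h ≤? k) (λ p → map (vert p) (allPaths k 0 h t)))
      ≈⟨ +-cong (total-done h≤k)
                (total-guard (suc h ≤? k) _ h≤k (λ p → total-map (vert p) (a (suc h)) (λ _ → ≡.refl) (allPaths k 0 h t))) ⟩
    e + a (suc h) * F h 0
      ≈⟨ solve 5 (λ e a′ f b′ l′ → e :+ a′ :* f := con 0 :+ (b′ :* con 0 :+ ((a′ :* f :+ l′ :* con 0) :+ e)))
           refl e (a (suc h)) (F h 0) (b (suc h)) (lam (suc h)) ⟩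
    rhsCoeff F E (suc h) 0 ∎
    where E = single t oneS ; e = E (suc h) 0
  F-first-step zero (suc n) h≤k = begin
    F 0 (suc n)
      ≈⟨ total-guard (0 ≤? k) steps h≤k (λ p → trans (total-++ (map (up p) U) (map (hor p) S))
                                                 (+-cong (total-up p U) (total-map (hor p) (b 0) (λ _ → ≡.refl) S))) ⟩
    F 1 n + b 0 * F 0 n
      ≈⟨ solve 5 (λ f₁ b′ f₀ a′ l′ → f₁ :+ b′ :* f₀ := f₁ :+ (b′ :* f₀ :+ ((a′ :* con 0 :+ l′ :* con 0) :+ con 0)))
           refl (F 1 n) (b 0) (F 0 n) (a 0) (lam 0) ⟩
    F 1 n + (b 0 * F 0 n + ((a 0 * 0# + lam 0 * 0#) + 0#))
      ≈⟨ +-congˡ (+-congˡ (+-congˡ (sym (single-suc 0 n)))) ⟩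
    rhsCoeff F (single t oneS) 0 (suc n) ∎
    where
    U = allPaths k n 1 t
    S = allPaths k n 0 t
    steps : 0 ≤ k → List (Path k (suc n) 0 t)
    steps p = map (up p) U ++ map (hor p) S
  F-first-step (suc h) (suc n) h≤k = begin
    F (suc h) (suc n)
      ≈⟨ total-guard (suc h ≤? k) steps h≤k (λ p →
           trans (total-++ (map (up p) U) _)
          (+-cong (total-up p U)
          (trans (total-++ (map (hor p) S) _)
          (+-cong (total-map (hor p) (b (suc h)) (λ _ → ≡.refl) S)
          (trans (total-++ (map (vert p) V) (map (diag p) D))
          (+-cong (total-map (vert p) (a (suc h)) (λ _ → ≡.refl) V)
                  (total-map (diag p) (lam (suc h)) (λ _ → ≡.refl) D))))))) ⟩
    F (suc (suc h)) n + (b (suc h) * F (suc h) n + (a (suc h) * F h (suc n) + lam (suc h) * F h n))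
      ≈⟨ +-congˡ (+-congˡ (sym (trans (+-congˡ (single-suc (suc h) n)) (+-identityʳ _)))) ⟩
    rhsCoeff F (single t oneS) (suc h) (suc n) ∎
    where
    U = allPaths k n (suc (suc h)) t
    S = allPaths k n (suc h) t
    V = allPaths k (suc n) h t
    D = allPaths k n h t
    steps : suc h ≤ k → List (Path k (suc n) (suc h) t)
    steps p = map (up p) U ++ map (hor p) S ++ map (vert p) V ++ map (diag p) D

  F-solves : IsSolution k (single t oneS) F
  F-solves = (λ h h≤k n → trans (F-first-step h n h≤k) (sym (rhs≈rhsCoeff F (single t oneS) h n))) , F-beyond

module GeneratingFunction {c ℓ} (R : CommutativeRing c ℓ) (b a lam : ℕ → CommutativeRing.Carrier R)
                          {k t : ℕ} (t≤k : t ≤ k) where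
  open Series R
  open PowerSeries R
  open PstarRecurrence R using (Pstar-isContinuant; Pstar-constant)
  open SeriesSystem R b a lam
  open Paths R b a lam k t using (F-solves)
  private module 𝕊 = CommutativeRing seriesRing
  open import Relation.Binary.Reasoning.Setoid 𝕊.setoid
  open import Algebra.Solver.Ring.NaturalCoefficients.Default 𝕊.commutativeSemiring
  open import Algebra.Definitions.RawSemiring (Semiring.rawSemiring 𝕊.semiring) using (_^_)

  K : ℕ → ℕ → Seq
  K = δPstar b a lam

  K-cont : ∀ j → IsContinuant B C j (K j)
  K-cont j = Pstar-isContinuant (shiftSeq j b) (shiftSeq j a) (shiftSeq j lam)

  open Candidate K K-cont t≤k

  I : Seq
  I = inv (Pstar b a lam (suc k))

  μ≋H⋆I : ∀ {h} → h ≤ k → (λ n → μ b a lam k n h t) ≋ (H h ⋆ I)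
  μ≋H⋆I = solution-unique F-solves
            (IsSolution-*ʳ I (single-*ʳ {d = I} P*ₖ₊₁⋆I≋1) candidate-solves) _
    where
    P*ₖ₊₁⋆I≋1 : (Pstar b a lam (suc k) ⋆ I) ≋ oneS
    P*ₖ₊₁⋆I≋1 = ⋆-inverseʳ (Pstar b a lam (suc k)) (Pstar-constant b a lam (suc k))

  prodLin≋∏A : ∀ m → prodLin a lam t m ≋ ∏A t m
  prodLin≋∏A zero    = 𝕊.refl
  prodLin≋∏A (suc m) = 𝕊.*-congʳ {A (t +ℕ suc m)} (prodLin≋∏A m)

  from-below : ∀ {r} → r ≤ t → (λ n → μ b a lam k n r t)
    ≋ (((Pstar b a lam r ⋆ δPstar b a lam (suc t) (k ∸ t)) ⋆ I) ⋆ xPow (t ∸ r))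
  from-below {r} r≤t = begin
    (λ n → μ b a lam k n r t)        ≈⟨ μ≋H⋆I (ℕ.≤-trans r≤t t≤k) ⟩
    H r ⋆ I                          ≈⟨ 𝕊.*-congʳ {I} (H-below r≤t) ⟩
    ((Q r ⋆ V t) ⋆ (x ^ (t ∸ r))) ⋆ I  ≈⟨ solve 4 (λ q v y i → ((q :* v) :* y) :* i := ((q :* v) :* i) :* y)
                                          𝕊.refl (Q r) (V t) (x ^ (t ∸ r)) I ⟩
    ((Q r ⋆ V t) ⋆ I) ⋆ (x ^ (t ∸ r))  ≈⟨ 𝕊.*-congˡ {(Q r ⋆ V t) ⋆ I} (𝕊.sym (xPow≋x^ (t ∸ r))) ⟩
    ((Q r ⋆ V t) ⋆ I) ⋆ xPow (t ∸ r) ∎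

  from-above : ∀ {r} → t < r → r ≤ k → (λ n → μ b a lam k n r t)
    ≋ (((Pstar b a lam t ⋆ δPstar b a lam (suc r) (k ∸ r)) ⋆ I) ⋆ prodLin a lam t (r ∸ t))
  from-above {r} t<r r≤k = begin
    (λ n → μ b a lam k n r t)                ≈⟨ μ≋H⋆I r≤k ⟩
    H r ⋆ I                                  ≈⟨ 𝕊.*-congʳ {I} (H-strictly-above t<r r≤k) ⟩
    ((Q t ⋆ V r) ⋆ Π r) ⋆ I                  ≈⟨ solve 4 (λ q v p i → ((q :* v) :* p) :* i := ((q :* v) :* i) :* p)
                                                  𝕊.refl (Q t) (V r) (Π r) I ⟩
    ((Q t ⋆ V r) ⋆ I) ⋆ Π r                  ≈⟨ 𝕊.*-congˡ {(Q t ⋆ V r) ⋆ I} (𝕊.sym (prodLin≋∏A (r ∸ t))) ⟩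
    ((Q t ⋆ V r) ⋆ I) ⋆ prodLin a lam t (r ∸ t) ∎

theorem5p3 : ∀ {c ℓ} (R : CommutativeRing c ℓ) →
    let open CommutativeRing R using (Carrier) in
    let open Series R in
    (b a lam : ℕ → Carrier) (r s k : ℕ) → r ≤ k → s ≤ k →
      (r ≤ s →
        (λ n → μ b a lam k n r s)
          ≋ (((Pstar b a lam r ⋆ δPstar b a lam (suc s) (k ∸ s))
               ⋆ inv (Pstar b a lam (suc k)))
              ⋆ xPow (s ∸ r)))
      × (s < r →
        (λ n → μ b a lam k n r s)
          ≋ (((Pstar b a lam s ⋆ δPstar b a lam (suc r) (k ∸ r))
               ⋆ inv (Pstar b a lam (suc k)))
              ⋆ prodLin a lam s (r ∸ s)))
theorem5p3 R b a lam r s k r≤k s≤k =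
  (λ r≤s → GeneratingFunction.from-below R b a lam s≤k r≤s) ,
  (λ s<r → GeneratingFunction.from-above R b a lam s≤k s<r r≤k)
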